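{- Let $\Gamma=(V,E)$ be a reflexive locally finite $k$-separable graph. Then $\Gamma$ is $k$-faithful or $\Gamma^-$ is $k$-faithful. Moreover, if $V$ is infinite, then $\Gamma$ is $k$-faithful.
   Context: A graph is a pair $\Gamma=(V,E)$ with $E\subseteq V\times V$. For $X\subseteq V$, $\Gamma(X)=\{y: (x,y)\in E\text{ for some }x\in X\}$, $\Gamma(x)=\Gamma(\{x\})$. $\Gamma$ is reflexive if $(x,x)\in E$ for all $x$. The reverse graph is $\Gamma^-=(V,\{(x,y):(y,x)\in E\})$. $\Gamma$ is locally finite if $\Gamma(x)$ and $\Gamma^-(x)$ are finite for all $x$. Board $\partial(X)=\Gamma(X)\setminus X$, exterior $\nabla(X)=V\setminus\Gamma(X)$. For $k\ge1$, $\Gamma$ is $k$-separable if some finite $X$ has $|X|\ge k$ and $|\nabla(X)|\ge k$; then $\kappa_k(\Gamma)=\min|\partial(X)|$ over such finite $X$. A $k$-fragment is a finite $X$ with $|X|\ge k$, $|\nabla(X)|\ge k$ and $|\partial(X)|=\kappa_k(\Gamma)$; a $k$-atom is a $k$-fragment of minimum cardinality. $\Gamma$ is $k$-faithful if $|A|\le|\nabla(A)|$ for the $k$-atoms $A$ of $\Gamma$. -}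

module Defs where

open import Level using (0ℓ)
open import Data.Nat using (ℕ; _≤_)
open import Data.Product using (Σ; ∃; _×_; _,_)
open import Data.Unit using (⊤)
open import Data.List using (List; length)
open import Data.List.Relation.Unary.All using (All)
open import Data.List.Relation.Unary.Unique.Propositional using (Unique)
open import Data.List.Membership.Propositional using (_∈_)
open import Relation.Nullary using (¬_)
open import Relation.Binary.PropositionalEquality using (_≡_)
open import Function.Bundles using (_⇔_)

record Graph : Set₁ where
  constructor mkGraph
  field
    V : Set
    E : V → V → Set

open Graph public

Subset : Set → Set₁
Subset V = V → Set

HasSize : {V : Set} → Subset V → ℕ → Set
HasSize {V} P n = Σ (List V) λ xs → Unique xs × length xs ≡ n × (∀ v → (v ∈ xs) ⇔ P v)

Finite : {V : Set} → Subset V → Set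
Finite P = ∃ λ n → HasSize P n

-- |P| ≥ n (P possibly infinite): P contains n distinct elements.
AtLeast : {V : Set} → Subset V → ℕ → Set
AtLeast {V} P n = Σ (List V) λ xs → Unique xs × length xs ≡ n × All P xs

InfiniteVertices : Graph → Set
InfiniteVertices G = ¬ Finite {V G} (λ _ → ⊤)

module _ (G : Graph) where
  Img : Subset (V G) → Subset (V G)
  Img X y = ∃ λ x → X x × E G x y

  Board : Subset (V G) → Subset (V G)
  Board X y = Img X y × ¬ X y

  Exterior : Subset (V G) → Subset (V G)
  Exterior X y = ¬ Img X y

  Reflexive : Set
  Reflexive = ∀ x → E G x x

  LocallyFinite : Set
  LocallyFinite = ∀ x → Finite (λ y → E G x y) × Finite (λ y → E G y x)

  Admissible : ℕ → Subset (V G) → Set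
  Admissible k X = Finite X × AtLeast X k × AtLeast (Exterior X) k

  Separable : ℕ → Set₁
  Separable k = ∃ λ (X : Subset (V G)) → Admissible k X

  -- k-fragment: admissible X with |∂(X)| = κ_k(Γ), i.e. |∂(X)| is
  -- minimal among |∂(Y)| over admissible Y.
  Fragment : ℕ → Subset (V G) → Set₁
  Fragment k X = Admissible k X ×
    (∃ λ m → HasSize (Board X) m ×
      (∀ (Y : Subset (V G)) → Admissible k Y → ∀ m' → HasSize (Board Y) m' → m ≤ m'))

  Atom : ℕ → Subset (V G) → Set₁
  Atom k A = Fragment k A ×
    (∃ λ a → HasSize A a ×
      (∀ (B : Subset (V G)) → Fragment k B → ∀ b → HasSize B b → a ≤ b))

  Faithful : ℕ → Set₁
  Faithful k = ∀ (A : Subset (V G)) → Atom k A → ∀ a → HasSize A a → AtLeast (Exterior A) a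

Rev : Graph → Graph
Rev G = mkGraph (V G) (λ x y → E G y x)

module Submission where

-- Infinite V: an atom A is finite, so by local finiteness Γ(A) is finite and
-- its complement ∇(A) is infinite; in particular |∇(A)| ≥ |A|.
--
-- Finite V: taking exteriors exchanges Γ and Γ⁻.  If X is admissible for Γ
-- then ∇(X) is admissible for Γ⁻, X ⊆ ∇⁻(∇(X)) and ∂⁻(∇(X)) ⊆ ∂(X); hence
-- κ_k(Γ⁻) ≤ κ_k(Γ) ≤ κ_k(Γ⁻) and ∇ maps k-fragments of Γ to k-fragments of Γ⁻.
-- If A is an atom of Γ with |∇A| < |A| and B an atom of Γ⁻ with |∇⁻B| < |B|,
-- minimality of atoms gives |A| ≤ |∇⁻B| < |B| ≤ |∇A| < |A|, a contradiction.

open import Defs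
open import Level using (0ℓ; suc; Lift; lift; lower)
open import Data.Nat using (ℕ; zero; _≥_; _≤_; _<_; _≤?_; z≤n; s≤s)
import Data.Nat as ℕ
open import Data.Nat.Properties using (≤-trans; <-irrefl; ≰⇒>; m≤n⇒m⊓n≡m; module ≤-Reasoning)
open import Data.Sum using (_⊎_; inj₁; inj₂)
open import Data.Product using (Σ; ∃; _×_; _,_; proj₁; proj₂)
open import Data.Unit using (⊤; tt)
open import Data.Empty using (⊥; ⊥-elim)
open import Data.List using (List; []; _∷_; _++_; length; take; filter; deduplicate; concatMap)
open import Data.List.Properties using (length-++-sucʳ; length-take)
open import Data.List.Relation.Unary.Any using (here; there)
import Data.List.Relation.Unary.Any as Any
import Data.List.Relation.Unary.All as All
open import Data.List.Relation.Unary.All using ([]; _∷_)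
open import Data.List.Relation.Unary.All.Properties using (¬Any⇒All¬) renaming (take⁺ to All-take⁺)
open import Data.List.Relation.Unary.AllPairs using ([]; _∷_)
open import Data.List.Relation.Unary.Unique.Propositional using (Unique)
import Data.List.Relation.Unary.Unique.Propositional.Properties as Unique
import Data.List.Relation.Unary.Unique.DecPropositional.Properties as UniqueDec
open import Data.List.Membership.Propositional using (_∈_; _∉_)
open import Data.List.Membership.Propositional.Properties
  using (∈-∃++; ∈-++⁺ˡ; ∈-++⁺ʳ; ∈-filter⁺; ∈-filter⁻; ∈-deduplicate⁺; ∈-concatMap⁺)
open import Relation.Nullary using (¬_; Dec; yes; no)
open import Relation.Nullary.Decidable using (map′)
open import Relation.Unary using (_⊆_; Decidable)
open import Relation.Binary.Definitions using (DecidableEquality)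
open import Relation.Binary.PropositionalEquality using (_≡_; _≢_; refl; sym; trans)
open import Function.Bundles using (mk⇔; Equivalence)
open import Axiom.ExcludedMiddle using (ExcludedMiddle)

open Equivalence using (to; from)

∈-remove : {A : Set} {v x : A} (us : List A) {vs : List A} →
  v ∈ us ++ x ∷ vs → v ≢ x → v ∈ us ++ vs
∈-remove []       (here v≡x) v≢x = ⊥-elim (v≢x v≡x)
∈-remove []       (there v∈) _   = v∈
∈-remove (u ∷ us) (here v≡u) _   = here v≡u
∈-remove (u ∷ us) (there v∈) v≢x = there (∈-remove us v∈ v≢x)

unique-length-≤ : {A : Set} {xs ys : List A} → Unique xs →
  (∀ {v} → v ∈ xs → v ∈ ys) → length xs ≤ length ys
unique-length-≤ {xs = []} _ _ = z≤n
unique-length-≤ {xs = x ∷ xs} (x∉xs ∷ unique) sub with ∈-∃++ (sub (here refl))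
... | us , vs , refl = begin
  ℕ.suc (length xs)         ≤⟨ s≤s (unique-length-≤ unique sub′) ⟩
  ℕ.suc (length (us ++ vs)) ≡⟨ sym (length-++-sucʳ us x vs) ⟩
  length (us ++ x ∷ vs)     ∎
  where
  open ≤-Reasoning
  sub′ : ∀ {v} → v ∈ xs → v ∈ us ++ vs
  sub′ v∈xs = ∈-remove us (sub (there v∈xs)) (λ v≡x → All.lookup x∉xs v∈xs (sym v≡x))

module _ {A : Set} where

  size-mono : {P Q : Subset A} {p q : ℕ} → HasSize P p → HasSize Q q → P ⊆ Q → p ≤ q
  size-mono (xs , unique , refl , memP) (ys , _ , refl , memQ) P⊆Q =
    unique-length-≤ unique (λ {v} v∈xs → from (memQ v) (P⊆Q (to (memP v) v∈xs)))

  atLeast-mono : {P Q : Subset A} {n : ℕ} → AtLeast P n → P ⊆ Q → AtLeast Q n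
  atLeast-mono (xs , unique , len , allP) P⊆Q = xs , unique , len , All.map P⊆Q allP

  atLeast-of-size : {P : Subset A} {m n : ℕ} → HasSize P m → n ≤ m → AtLeast P n
  atLeast-of-size {n = n} (xs , unique , refl , memP) n≤m =
    take n xs , Unique.take⁺ n unique , trans (length-take n xs) (m≤n⇒m⊓n≡m n≤m) ,
    All-take⁺ n (All.tabulate (λ {v} → to (memP v)))

  size-below : {P : Subset A} {n : ℕ} → Finite P → ¬ AtLeast P n →
    ∃ λ m → HasSize P m × m < n
  size-below {n = n} (m , sizeP) small with n ≤? m
  ... | yes n≤m = ⊥-elim (small (atLeast-of-size sizeP n≤m))
  ... | no n≰m  = m , sizeP , ≰⇒> n≰m

  enumeration : {P : Subset A} → Finite P → List A
  enumeration (_ , xs , _) = xs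

  enumeration-complete : {P : Subset A} (finP : Finite P) → P ⊆ (_∈ enumeration finP)
  enumeration-complete (_ , _ , _ , _ , memP) {v} = from (memP v)

-- Types all of whose subsets are finite; classically, the finite types.
-- This is the form in which finiteness of V is used.
EverySubsetFinite : Set → Set₁
EverySubsetFinite A = (P : Subset A) → Finite P

-- X ⊆ ∇⁻(∇(X)): a Γ⁻-neighbour z of x ∈ X is a Γ-successor of x, so z ∉ ∇(X).
inside-double-exterior : (H : Graph) {X : Subset (V H)} →
  X ⊆ Exterior (Rev H) (Exterior H X)
inside-double-exterior H {x = x} Xx (z , z∈∇X , z→x) = z∈∇X (x , Xx , z→x)

exterior-admissible : (H : Graph) → EverySubsetFinite (V H) → {k : ℕ} {X : Subset (V H)} →
  Admissible H k X → Admissible (Rev H) k (Exterior H X)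
exterior-admissible H fin (_ , largeX , largeExt) =
  fin _ , largeExt , atLeast-mono largeX (inside-double-exterior H)

image-covered : (G : Graph) → LocallyFinite G → {X : Subset (V G)} → Finite X →
  Σ (List (V G)) λ L → Img G X ⊆ (_∈ L)
image-covered G lf {X} finX = concatMap successors (enumeration finX) , covers
  where
  successors : V G → List (V G)
  successors x = enumeration (proj₁ (lf x))
  covers : Img G X ⊆ (_∈ concatMap successors (enumeration finX))
  covers (x , Xx , x→v) = ∈-concatMap⁺ successors (Any.map (λ { refl → enumeration-complete (proj₁ (lf x)) x→v })
                                                           (enumeration-complete finX Xx))

atom-minimal : (H : Graph) {k : ℕ} {A B : Subset (V H)} {a b : ℕ} →
  Atom H k A → HasSize A a → Fragment H k B → HasSize B b → a ≤ b
atom-minimal H (_ , a′ , sizeA′ , minimal) sizeA fragB sizeB =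
  ≤-trans (size-mono sizeA sizeA′ (λ Ax → Ax)) (minimal _ fragB _ sizeB)

Counterexample : Graph → ℕ → Set₁
Counterexample H k = Σ (Subset (V H)) λ A → Atom H k A ×
  Σ ℕ λ a → Σ ℕ λ e → HasSize A a × HasSize (Exterior H A) e × e < a

module Classical (lem : ExcludedMiddle (suc 0ℓ)) where

  decide : (P : Set) → Dec P
  decide P = map′ lower lift (lem {Lift (suc 0ℓ) P})

  finite-from-cover : {A : Set} (P : Subset A) (L : List A) → P ⊆ (_∈ L) → Finite P
  finite-from-cover {A} P L covers =
    length ys , ys , unique , refl , λ v → mk⇔ (λ v∈ys → proj₂ (∈-filter⁻ P? {xs = deduplicate _≟_ L} v∈ys))
                                               (λ Pv → ∈-filter⁺ P? (∈-deduplicate⁺ _≟_ (covers Pv)) Pv)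
    where
    _≟_ : DecidableEquality A
    x ≟ y = decide (x ≡ y)
    P? : Decidable P
    P? v = decide (P v)
    ys : List A
    ys = filter P? (deduplicate _≟_ L)
    unique : Unique ys
    unique = Unique.filter⁺ P? (UniqueDec.deduplicate-! _≟_ L)

  every-subset-finite : {A : Set} → Finite {A} (λ _ → ⊤) → EverySubsetFinite A
  every-subset-finite finA P = finite-from-cover P (enumeration finA) (λ _ → enumeration-complete finA tt)

  cofinite-large : {A : Set} {P : Subset A} (L : List A) → ¬ Finite {A} (λ _ → ⊤) →
    (∀ v → P v ⊎ v ∈ L) → ∀ n → AtLeast P n
  cofinite-large L infinite P-or-L zero = [] , [] , refl , []
  cofinite-large {P = P} L infinite P-or-L (ℕ.suc n)
    with cofinite-large L infinite P-or-L n
  ... | xs , unique , refl , allP with decide (∃ λ v → P v × v ∉ xs)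
  ... | yes (v , Pv , v∉xs) = v ∷ xs , ¬Any⇒All¬ xs v∉xs ∷ unique , refl , Pv ∷ allP
  ... | no exhausted = ⊥-elim (infinite (finite-from-cover _ (xs ++ L) (λ {v} _ → listed v)))
    where
    listed : ∀ v → v ∈ xs ++ L
    listed v with P-or-L v | decide (v ∈ xs)
    ... | inj₂ v∈L | _       = ∈-++⁺ʳ xs v∈L
    ... | inj₁ _   | yes v∈xs = ∈-++⁺ˡ v∈xs
    ... | inj₁ Pv  | no v∉xs = ⊥-elim (exhausted (v , Pv , v∉xs))

  infinite-exterior : (G : Graph) → LocallyFinite G → InfiniteVertices G →
    {X : Subset (V G)} → Finite X → ∀ n → AtLeast (Exterior G X) n
  infinite-exterior G lf infinite finX = cofinite-large L infinite exterior-or-L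
    where
    L : List (V G)
    L = proj₁ (image-covered G lf finX)
    exterior-or-L : ∀ v → Exterior G _ v ⊎ v ∈ L
    exterior-or-L v with decide (Img G _ v)
    ... | yes v∈ΓX = inj₂ (proj₂ (image-covered G lf finX) v∈ΓX)
    ... | no v∉ΓX  = inj₁ v∉ΓX

  infinite-faithful : (G : Graph) (k : ℕ) → LocallyFinite G → InfiniteVertices G → Faithful G k
  infinite-faithful G k lf infinite A _ a sizeA = infinite-exterior G lf infinite (a , sizeA) a

  -- ∂⁻(∇(X)) ⊆ ∂(X): such a vertex is not in ∇(X), hence in Γ(X), and it
  -- has a Γ-successor outside Γ(X), hence is not in X.
  board-of-exterior : (H : Graph) {X : Subset (V H)} →
    Board (Rev H) (Exterior H X) ⊆ Board H X
  board-of-exterior H {X} {y} ((z , z∈∇X , y→z) , y∉∇X) with decide (Img H X y)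
  ... | yes y∈ΓX = y∈ΓX , λ Xy → z∈∇X (y , Xy , y→z)
  ... | no y∉ΓX  = ⊥-elim (y∉∇X y∉ΓX)

  module _ (H : Graph) (fin : EverySubsetFinite (V H)) {k : ℕ} where

    -- ∇ maps k-fragments of H to k-fragments of H⁻; the board minimality uses
    -- the inclusions of boards in both directions.
    exterior-fragment : {X : Subset (V H)} → Fragment H k X → Fragment (Rev H) k (Exterior H X)
    exterior-fragment {X} (admX , m , sizeX , minimalX) =
      exterior-admissible H fin admX , proj₁ boardSize , proj₂ boardSize , minimal
      where
      boardSize : Finite (Board (Rev H) (Exterior H X))
      boardSize = fin (Board (Rev H) (Exterior H X))
      minimal : ∀ Y → Admissible (Rev H) k Y → ∀ n → HasSize (Board (Rev H) Y) n → proj₁ boardSize ≤ n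
      minimal Y admY n sizeY = begin
        proj₁ boardSize ≤⟨ size-mono (proj₂ boardSize) sizeX (board-of-exterior H) ⟩
        m               ≤⟨ minimalX _ (exterior-admissible (Rev H) fin admY) _ (proj₂ boardY) ⟩
        proj₁ boardY    ≤⟨ size-mono (proj₂ boardY) sizeY (board-of-exterior (Rev H)) ⟩
        n               ∎
        where
        open ≤-Reasoning
        boardY : Finite (Board H (Exterior (Rev H) Y))
        boardY = fin (Board H (Exterior (Rev H) Y))

    faithful-or-counterexample : Faithful H k ⊎ Counterexample H k
    faithful-or-counterexample with lem {Counterexample H k}
    ... | yes counterexample = inj₂ counterexample
    ... | no none = inj₁ faithful
      where
      faithful : Faithful H k
      faithful A atom a sizeA with decide (AtLeast (Exterior H A) a)
      ... | yes large = large
      ... | no small  =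
        let (e , sizeE , e<a) = size-below (fin _) small
        in ⊥-elim (none (A , atom , a , e , sizeA , sizeE , e<a))

  -- Finite V: G and G⁻ cannot both have an atom violating faithfulness,
  -- since |A| ≤ |∇⁻B| < |B| ≤ |∇A| < |A|.
  no-dual-counterexamples : (G : Graph) → EverySubsetFinite (V G) → {k : ℕ} →
    Counterexample G k → Counterexample (Rev G) k → ⊥
  no-dual-counterexamples G fin (A , atomA , a , e , sizeA , sizeE , e<a)
                                (B , atomB , b , f , sizeB , sizeF , f<b) = <-irrefl refl (begin-strict
    a ≤⟨ atom-minimal G atomA sizeA (exterior-fragment (Rev G) fin (proj₁ atomB)) sizeF ⟩
    f <⟨ f<b ⟩
    b ≤⟨ atom-minimal (Rev G) atomB sizeB (exterior-fragment G fin (proj₁ atomA)) sizeE ⟩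
    e <⟨ e<a ⟩
    a ∎)
    where open ≤-Reasoning

  finite-faithful-or-reverse : (G : Graph) → EverySubsetFinite (V G) → (k : ℕ) →
    Faithful G k ⊎ Faithful (Rev G) k
  finite-faithful-or-reverse G fin k
    with faithful-or-counterexample G fin | faithful-or-counterexample (Rev G) fin
  ... | inj₁ faithful | _              = inj₁ faithful
  ... | inj₂ _        | inj₁ faithful  = inj₂ faithful
  ... | inj₂ bad      | inj₂ bad⁻      = ⊥-elim (no-dual-counterexamples G fin bad bad⁻)

  faithful-or-reverse : (G : Graph) (k : ℕ) → LocallyFinite G → Faithful G k ⊎ Faithful (Rev G) k
  faithful-or-reverse G k lf with decide (Finite {V G} (λ _ → ⊤))
  ... | yes finite  = finite-faithful-or-reverse G (every-subset-finite finite) k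
  ... | no infinite = inj₁ (infinite-faithful G k lf infinite)

lemma4p2 : ExcludedMiddle (suc 0ℓ) →
    (G : Graph) (k : ℕ) → k ≥ 1 →
    Reflexive G → LocallyFinite G → Separable G k →
    (Faithful G k ⊎ Faithful (Rev G) k) × (InfiniteVertices G → Faithful G k)
lemma4p2 lem G k _ _ lf _ = faithful-or-reverse G k lf , infinite-faithful G k lf
  where open Classical lem
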